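{- Let $G$ be a connected finite simple graph with $2n$ vertices which has a nice perfect matching. Then $gf(G)\geq n-1$.
   Context: For a perfect matching $M$ of $G$, $af(G,M)$ is the minimum size of a subset $S\subseteq E(G)\setminus M$ such that $G-S$ has a unique perfect matching, and $Af(G)=\max_M af(G,M)$. It is known that $af(G,M)\leq Af(G)\leq \frac{2|E(G)|-|V(G)|}{4}$ for every perfect matching $M$; a perfect matching $M$ is called nice if $af(G,M)=Af(G)=\frac{2|E(G)|-|V(G)|}{4}$. $gf(G)$ is the minimum size of an edge subset $S$ such that no two distinct perfect matchings $M_1,M_2$ of $G$ satisfy $M_1\cap S=M_2\cap S$. -}

module Defs where

open import Data.Nat using (ℕ; zero; suc; _+_; _*_; _≤_; _<_)
open import Data.Fin as F using (Fin)
open import Data.Fin.Subset using (Subset; _∈_; _∉_; _⊆_; ∁; _∩_; ∣_∣)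
open import Data.Product using (Σ; ∃; ∃-syntax; _×_; _,_; proj₁; proj₂)
open import Data.Sum using (_⊎_)
open import Relation.Binary.PropositionalEquality using (_≡_; _≢_)

-- A finite simple graph on the vertex set Fin N.
-- Its edges are indexed by Fin m; edge e = (u , w) with u < w (no loops,
-- each unordered pair written in a canonical order), and distinct indices
-- give distinct pairs (no multiple edges).
record Graph (N : ℕ) : Set where
  field
    m         : ℕ
    edge      : Fin m → Fin N × Fin N
    ordered   : ∀ e → proj₁ (edge e) F.< proj₂ (edge e)
    injective : ∀ e e′ → edge e ≡ edge e′ → e ≡ e′
open Graph public

module _ {N : ℕ} (G : Graph N) where

  Incident : Fin N → Fin (m G) → Set
  Incident v e = v ≡ proj₁ (edge G e) ⊎ v ≡ proj₂ (edge G e)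

  Adjacent : Fin N → Fin N → Set
  Adjacent u v = ∃[ e ] ((edge G e ≡ (u , v)) ⊎ (edge G e ≡ (v , u)))

  data Reachable : Fin N → Fin N → Set where
    here : ∀ {u} → Reachable u u
    step : ∀ {u v w} → Adjacent u v → Reachable v w → Reachable u w

  Connected : Set
  Connected = ∀ u v → Reachable u v

  PerfectMatching : Subset (m G) → Set
  PerfectMatching M = ∀ v → ∃[ e ] (e ∈ M × Incident v e ×
                        (∀ e′ → e′ ∈ M → Incident v e′ → e′ ≡ e))

  -- perfect matchings of G - S are exactly the perfect matchings of G
  -- avoiding S (G - S has the same vertex set)
  PerfectMatchingAvoiding : Subset (m G) → Subset (m G) → Set
  PerfectMatchingAvoiding S M = PerfectMatching M × (∀ e → e ∈ M → e ∉ S)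

  UniquePM-minus : Subset (m G) → Set
  UniquePM-minus S = ∃[ M ] (PerfectMatchingAvoiding S M ×
                       (∀ M′ → PerfectMatchingAvoiding S M′ → M′ ≡ M))

  AntiForcingSet : Subset (m G) → Subset (m G) → Set
  AntiForcingSet M S = S ⊆ ∁ M × UniquePM-minus S

  IsAf : Subset (m G) → ℕ → Set
  IsAf M k = (∃[ S ] (AntiForcingSet M S × ∣ S ∣ ≡ k)) ×
             (∀ S → AntiForcingSet M S → k ≤ ∣ S ∣)

  IsAfMax : ℕ → Set
  IsAfMax k = (∃[ M ] (PerfectMatching M × IsAf M k)) ×
              (∀ M j → PerfectMatching M → IsAf M j → j ≤ k)

  -- M is nice: af(G,M) = Af(G) = (2|E(G)| - |V(G)|)/4
  -- (the last equality written as 4 * Af(G) + |V(G)| = 2 * |E(G)|)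
  Nice : Subset (m G) → Set
  Nice M = PerfectMatching M ×
           ∃[ k ] (IsAf M k × IsAfMax k × 4 * k + N ≡ 2 * m G)

  HasNicePerfectMatching : Set
  HasNicePerfectMatching = ∃[ M ] Nice M

  GlobalForcingSet : Subset (m G) → Set
  GlobalForcingSet S = ∀ M₁ M₂ → PerfectMatching M₁ → PerfectMatching M₂ →
                       M₁ ∩ S ≡ M₂ ∩ S → M₁ ≡ M₂

  IsGf : ℕ → Set
  IsGf k = (∃[ S ] (GlobalForcingSet S × ∣ S ∣ ≡ k)) ×
           (∀ S → GlobalForcingSet S → k ≤ ∣ S ∣)

-- Let k = af(G,M) for the nice matching M, so that |E(G) ∖ M| = 2k.  Rank the edges of M and label
-- one end of each: the non-matching edges whose lower-ranked end is labelled form an anti-forcing set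
-- of M, and flipping every label gives a second one, disjoint from the first with union E(G) ∖ M.
-- Both have at least k edges, hence exactly k, so no anti-forcing set lies strictly inside either.
-- For two matching edges g, h ranked last this shows that if one end of g is adjacent to an end of h,
-- so is the other: any two adjacent edges of M span an M-alternating 4-cycle.  Now grow a union W of
-- M-edges one edge e at a time, attached through such a cycle e x₁ f x₂ to an edge f inside W.  A set
-- X separating the perfect matchings that agree with M outside W ∪ e contains e, x₁ or x₂, or else it
-- contains f (swapping M along the cycle would be invisible to X) and X without f separates for W.
-- Hence X has at least |W|/2 − 1 edges inside W, and W = V(G) gives gf(G) ≥ n − 1.

module Submission where

open import Data.Bool using (Bool; true; false; not; _∧_; _∨_; _xor_; if_then_else_)
open import Data.Bool.Properties using (not-distribʳ-xor; ∧-zeroʳ; ∨-zeroʳ)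
open import Data.Empty using (⊥; ⊥-elim)
open import Data.Fin as F using (Fin; toℕ)
import Data.Fin.Properties as FP
open import Data.Fin.Subset using (Subset; _∈_; _∉_; _⊆_; _⊂_; ∁; ∣_∣)
open import Data.Fin.Subset.Properties
  using (_∈?_; ⊆-antisym; p⊂q⇒∣p∣<∣q∣; x∉p⇒x∈∁p; ∣∁p∣≡n∸∣p∣)
open import Data.Nat using (ℕ; zero; suc; _+_; _*_; _∸_; _≤_; _<_; _<?_; z≤n)
open import Data.Nat.Properties
open import Data.Nat.Solver using (module +-*-Solver)
open import Algebra.Properties.CommutativeSemigroup +-commutativeSemigroup using (interchange)
open import Data.Product using (∃-syntax; _×_; _,_; proj₁; proj₂)
open import Data.Sum using (_⊎_; inj₁; inj₂; [_,_]′)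
open import Data.Vec using ([]; _∷_; lookup; tabulate)
open import Data.Vec.Properties
  using ( []=⇒lookup; lookup⇒[]=; lookup-zipWith; lookup-map
        ; lookup∘tabulate; tabulate∘lookup; tabulate-cong)
open import Function using (_∘_)
open import Relation.Nullary using (¬_; Dec; yes; no; does)
open import Relation.Binary using (tri<; tri≈; tri>)
open import Relation.Nullary.Decidable using (dec-true; dec-false; _×-dec_; _⊎-dec_)
open import Relation.Binary.PropositionalEquality
  using (_≡_; _≢_; refl; sym; trans; cong; cong₂; subst; subst₂; ≢-sym; module ≡-Reasoning)

open import Defs

∑ : ∀ {k} → (Fin k → ℕ) → ℕ
∑ {zero}  f = 0
∑ {suc k} f = f F.zero + ∑ (f ∘ F.suc)

∑-cong : ∀ {k} {f g : Fin k → ℕ} → (∀ i → f i ≡ g i) → ∑ f ≡ ∑ g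
∑-cong {zero}  f≗g = refl
∑-cong {suc k} f≗g = cong₂ _+_ (f≗g F.zero) (∑-cong (f≗g ∘ F.suc))

∑-+ : ∀ {k} (f g : Fin k → ℕ) → ∑ (λ i → f i + g i) ≡ ∑ f + ∑ g
∑-+ {zero}  f g = refl
∑-+ {suc k} f g = trans (cong (f F.zero + g F.zero +_) (∑-+ (f ∘ F.suc) (g ∘ F.suc)))
                        (interchange (f F.zero) (g F.zero) (∑ (f ∘ F.suc)) (∑ (g ∘ F.suc)))

∑-zero : ∀ k → ∑ {k} (λ _ → 0) ≡ 0
∑-zero zero    = refl
∑-zero (suc k) = ∑-zero k

∑-one : ∀ k → ∑ {k} (λ _ → 1) ≡ k
∑-one zero    = refl
∑-one (suc k) = cong suc (∑-one k)

∑-swap : ∀ {k l} (h : Fin k → Fin l → ℕ) →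
         ∑ (λ i → ∑ (h i)) ≡ ∑ (λ j → ∑ (λ i → h i j))
∑-swap {zero}  {l} h = sym (∑-zero l)
∑-swap {suc k}     h = trans (cong (∑ (h F.zero) +_) (∑-swap (h ∘ F.suc)))
                             (sym (∑-+ (h F.zero) (λ j → ∑ (λ i → h (F.suc i) j))))

∑-mono : ∀ {k} {f g : Fin k → ℕ} → (∀ i → f i ≤ g i) → ∑ f ≤ ∑ g
∑-mono {zero}  f≤g = z≤n
∑-mono {suc k} f≤g = +-mono-≤ (f≤g F.zero) (∑-mono (f≤g ∘ F.suc))

∑-mono-< : ∀ {k} {f g : Fin k → ℕ} → (∀ i → f i ≤ g i) → ∀ j → f j < g j → ∑ f < ∑ g
∑-mono-< f≤g F.zero    fj<gj = +-mono-<-≤ fj<gj (∑-mono (f≤g ∘ F.suc))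
∑-mono-< f≤g (F.suc j) fj<gj = +-mono-≤-< (f≤g F.zero) (∑-mono-< (f≤g ∘ F.suc) j fj<gj)

[_] : Bool → ℕ
[ true ]  = 1
[ false ] = 0

count : ∀ {k} → (Fin k → Bool) → ℕ
count f = ∑ ([_] ∘ f)

[]-mono : ∀ {a b} → (a ≡ true → b ≡ true) → [ a ] ≤ [ b ]
[]-mono {false}     a⇒b = z≤n
[]-mono {true}  {b} a⇒b rewrite a⇒b refl = ≤-refl

count-mono : ∀ {k} (f g : Fin k → Bool) → (∀ i → f i ≡ true → g i ≡ true) → count f ≤ count g
count-mono f g f⇒g = ∑-mono ([]-mono ∘ f⇒g)

count-mono-< : ∀ {k} (f g : Fin k → Bool) → (∀ i → f i ≡ true → g i ≡ true) →
               ∀ j → f j ≡ false → g j ≡ true → count f < count g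
count-mono-< f g f⇒g j fj gj =
  ∑-mono-< ([]-mono ∘ f⇒g) j (subst₂ (λ a b → [ a ] < [ b ]) (sym fj) (sym gj) ≤-refl)

count-false : ∀ {k} {f : Fin k → Bool} → count f < k → ∃[ i ] f i ≡ false
count-false {suc k} {f} count<k with f F.zero in f0
... | false = F.zero , f0
... | true  = let i , fi = count-false (≤-pred count<k) in F.suc i , fi

count-≟ : ∀ {k} (p : Fin k) → count (λ i → does (i F.≟ p)) ≡ 1
count-≟ {suc k} F.zero    = cong suc (∑-zero k)
count-≟         (F.suc p) = count-≟ p

count-≟′ : ∀ {k} (p : Fin k) → count (λ i → does (p F.≟ i)) ≡ 1
count-≟′ {suc k} F.zero    = cong suc (∑-zero k)
count-≟′         (F.suc p) = count-≟′ p

true≢false : true ≢ false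
true≢false ()

lookup⇒∈ : ∀ {k} {p : Subset k} {i} → lookup p i ≡ true → i ∈ p
lookup⇒∈ {p = p} {i} = lookup⇒[]= i p

∉⇒lookup : ∀ {k} {p : Subset k} {i} → i ∉ p → lookup p i ≡ false
∉⇒lookup {p = p} {i} i∉p with lookup p i in pi
... | true  = ⊥-elim (i∉p (lookup⇒∈ pi))
... | false = refl

lookup-injective : ∀ {k} {p q : Subset k} → (∀ i → lookup p i ≡ lookup q i) → p ≡ q
lookup-injective {p = p} {q} p≗q =
  trans (sym (tabulate∘lookup p)) (trans (tabulate-cong p≗q) (tabulate∘lookup q))

∣p∣≡count : ∀ {k} (p : Subset k) → ∣ p ∣ ≡ count (lookup p)
∣p∣≡count []          = refl
∣p∣≡count (true ∷ p)  = cong suc (∣p∣≡count p)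
∣p∣≡count (false ∷ p) = ∣p∣≡count p

∣tabulate∣≡count : ∀ {k} (f : Fin k → Bool) → ∣ tabulate f ∣ ≡ count f
∣tabulate∣≡count f = trans (∣p∣≡count (tabulate f)) (∑-cong (cong [_] ∘ lookup∘tabulate f))

[∧]+[∧not] : ∀ a b → [ a ∧ b ] + [ a ∧ not b ] ≡ [ a ]
[∧]+[∧not] false _     = refl
[∧]+[∧not] true  true  = refl
[∧]+[∧not] true  false = refl

_without_ : ∀ {k} → (Fin k → Bool) → Fin k → Fin k → Bool
(X without f) x = if does (x F.≟ f) then false else X x

∧-mapʳ : ∀ a {b c} → (b ≡ true → c ≡ true) → a ∧ b ≡ true → a ∧ c ≡ true
∧-mapʳ true b⇒c = b⇒c

∧-projˡ : ∀ {a b} → a ∧ b ≡ true → a ≡ true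
∧-projˡ {true} b≡true = refl

module _ {N : ℕ} (G : Graph N) where

  fst snd : Fin (m G) → Fin N
  fst e = proj₁ (edge G e)
  snd e = proj₂ (edge G e)

  Inc : Fin N → Fin (m G) → Set
  Inc = Incident G

  fst≢snd : ∀ e → fst e ≢ snd e
  fst≢snd e fst≡snd = FP.<-irrefl fst≡snd (ordered G e)

  inc? : ∀ a e → Dec (Inc a e)
  inc? a e = (a F.≟ fst e) ⊎-dec (a F.≟ snd e)

  ends : ∀ {a b e} → Inc a e → Inc b e → a ≢ b →
         (a ≡ fst e × b ≡ snd e) ⊎ (a ≡ snd e × b ≡ fst e)
  ends (inj₁ a≡) (inj₁ b≡) a≢b = ⊥-elim (a≢b (trans a≡ (sym b≡)))
  ends (inj₁ a≡) (inj₂ b≡) a≢b = inj₁ (a≡ , b≡)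
  ends (inj₂ a≡) (inj₁ b≡) a≢b = inj₂ (a≡ , b≡)
  ends (inj₂ a≡) (inj₂ b≡) a≢b = ⊥-elim (a≢b (trans a≡ (sym b≡)))

  inc-≡⊎≡ : ∀ {a b c e} → Inc a e → Inc b e → a ≢ b → Inc c e → c ≡ a ⊎ c ≡ b
  inc-≡⊎≡ ae be a≢b (inj₁ c≡) with ends ae be a≢b
  ... | inj₁ (a≡ , _) = inj₁ (trans c≡ (sym a≡))
  ... | inj₂ (_ , b≡) = inj₂ (trans c≡ (sym b≡))
  inc-≡⊎≡ ae be a≢b (inj₂ c≡) with ends ae be a≢b
  ... | inj₁ (_ , b≡) = inj₂ (trans c≡ (sym b≡))
  ... | inj₂ (a≡ , _) = inj₁ (trans c≡ (sym a≡))

  edge-unique : ∀ {a b e e′} → a ≢ b → Inc a e → Inc b e → Inc a e′ → Inc b e′ → e ≡ e′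
  edge-unique {e = e} {e′} a≢b ae be ae′ be′ with ends ae be a≢b | ends ae′ be′ a≢b
  ... | inj₁ (a≡ , b≡) | inj₁ (a≡′ , b≡′) =
    injective G e e′ (cong₂ _,_ (trans (sym a≡) a≡′) (trans (sym b≡) b≡′))
  ... | inj₂ (a≡ , b≡) | inj₂ (a≡′ , b≡′) =
    injective G e e′ (cong₂ _,_ (trans (sym b≡) b≡′) (trans (sym a≡) a≡′))
  ... | inj₁ (a≡ , b≡) | inj₂ (a≡′ , b≡′) = ⊥-elim (FP.<-asym (ordered G e)
    (subst₂ F._<_ (trans (sym b≡′) b≡) (trans (sym a≡′) a≡) (ordered G e′)))
  ... | inj₂ (a≡ , b≡) | inj₁ (a≡′ , b≡′) = ⊥-elim (FP.<-asym (ordered G e)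
    (subst₂ F._<_ (trans (sym a≡′) a≡) (trans (sym b≡′) b≡) (ordered G e′)))

  other-end : ∀ {a e} → Inc a e → ∃[ b ] (Inc b e × a ≢ b)
  other-end {e = e} (inj₁ refl) = snd e , inj₂ refl , fst≢snd e
  other-end {e = e} (inj₂ refl) = fst e , inj₁ refl , ≢-sym (fst≢snd e)

  Adj : Fin N → Fin N → Set
  Adj a b = ∃[ e ] (Inc a e × Inc b e)

  adj? : ∀ a b → Dec (Adj a b)
  adj? a b = FP.any? (λ e → inc? a e ×-dec inc? b e)

  adj-sym : ∀ {a b} → Adj a b → Adj b a
  adj-sym (e , ae , be) = e , be , ae

  Adjacent⇒Adj : ∀ {u v} → Adjacent G u v → Adj u v
  Adjacent⇒Adj (e , inj₁ uv) = e , inj₁ (cong proj₁ (sym uv)) , inj₂ (cong proj₂ (sym uv))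
  Adjacent⇒Adj (e , inj₂ vu) = e , inj₂ (cong proj₂ (sym vu)) , inj₁ (cong proj₁ (sym vu))

  crossing-edge : ∀ (W : Fin N → Bool) {u v} → Reachable G u v → W u ≡ true → W v ≡ false →
                  ∃[ a ] ∃[ b ] (W a ≡ false × W b ≡ true × Adj a b)
  crossing-edge W here Wu Wv = ⊥-elim (true≢false (trans (sym Wu) Wv))
  crossing-edge W {u} (step {v = t} u~t t⇝v) Wu Wv with W t in Wt
  ... | true  = crossing-edge W t⇝v Wt Wv
  ... | false = t , u , Wt , Wu , adj-sym (Adjacent⇒Adj u~t)

  AdjTo : Fin N → Fin (m G) → Set
  AdjTo v h = ∃[ t ] (Inc t h × Adj v t)

  adjTo? : ∀ v h → Dec (AdjTo v h)
  adjTo? v h with adj? v (fst h) | adj? v (snd h)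
  ... | yes v~fst | _        = yes (fst h , inj₁ refl , v~fst)
  ... | no _      | yes v~snd = yes (snd h , inj₂ refl , v~snd)
  ... | no v≁fst  | no v≁snd  =
    no λ { (t , inj₁ refl , v~t) → v≁fst v~t ; (t , inj₂ refl , v~t) → v≁snd v~t }

  pm-unique : ∀ {P} → PerfectMatching G P →
              ∀ {v e e′} → e ∈ P → e′ ∈ P → Inc v e → Inc v e′ → e ≡ e′
  pm-unique pmP {v} e∈P e′∈P ve ve′ =
    let _ , _ , _ , unique = pmP v in trans (unique _ e∈P ve) (sym (unique _ e′∈P ve′))

  -- Swapping a perfect matching along an alternating 4-cycle

  record AlternatingSquare (e f : Fin (m G)) : Set where
    field
      p q r s : Fin N
      x₁ x₂   : Fin (m G)
      p∈e : Inc p e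
      q∈e : Inc q e
      p≢q : p ≢ q
      r∈f : Inc r f
      s∈f : Inc s f
      r≢s : r ≢ s
      p∈x₁ : Inc p x₁
      r∈x₁ : Inc r x₁
      q∈x₂ : Inc q x₂
      s∈x₂ : Inc s x₂

  square : ∀ {e f p q r s} → Inc p e → Inc q e → p ≢ q → Inc r f → Inc s f → r ≢ s →
           Adj p r → Adj q s → AlternatingSquare e f
  square p∈e q∈e p≢q r∈f s∈f r≢s (x₁ , p∈x₁ , r∈x₁) (x₂ , q∈x₂ , s∈x₂) = record
    { p∈e = p∈e ; q∈e = q∈e ; p≢q = p≢q ; r∈f = r∈f ; s∈f = s∈f ; r≢s = r≢s
    ; p∈x₁ = p∈x₁ ; r∈x₁ = r∈x₁ ; q∈x₂ = q∈x₂ ; s∈x₂ = s∈x₂ }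

  module Swap {P} (pmP : PerfectMatching G P) {e f} (e∈P : e ∈ P) (f∈P : f ∈ P) (e≢f : e ≢ f)
              (sq : AlternatingSquare e f) where
    open AlternatingSquare sq

    disjoint : ∀ {v} → Inc v e → Inc v f → ⊥
    disjoint ve vf = e≢f (pm-unique pmP e∈P f∈P ve vf)

    x₁≢e : x₁ ≢ e
    x₁≢e x₁≡e = disjoint (subst (Inc r) x₁≡e r∈x₁) r∈f
    x₂≢e : x₂ ≢ e
    x₂≢e x₂≡e = disjoint (subst (Inc s) x₂≡e s∈x₂) s∈f
    x₁≢f : x₁ ≢ f
    x₁≢f x₁≡f = disjoint p∈e (subst (Inc p) x₁≡f p∈x₁)
    x₂≢f : x₂ ≢ f
    x₂≢f x₂≡f = disjoint q∈e (subst (Inc q) x₂≡f q∈x₂)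

    p≢r : p ≢ r
    p≢r refl = disjoint p∈e r∈f
    q≢s : q ≢ s
    q≢s refl = disjoint q∈e s∈f

    on-x₁ : ∀ {v} → Inc v x₁ → v ≡ p ⊎ v ≡ r
    on-x₁ = inc-≡⊎≡ p∈x₁ r∈x₁ p≢r
    on-x₂ : ∀ {v} → Inc v x₂ → v ≡ q ⊎ v ≡ s
    on-x₂ = inc-≡⊎≡ q∈x₂ s∈x₂ q≢s

    not-on-both : ∀ {v} → Inc v x₁ → Inc v x₂ → ⊥
    not-on-both v∈x₁ v∈x₂ with on-x₁ v∈x₁ | on-x₂ v∈x₂
    ... | inj₁ refl | inj₁ v≡q  = p≢q v≡q
    ... | inj₁ refl | inj₂ refl = disjoint p∈e s∈f
    ... | inj₂ refl | inj₁ refl = disjoint q∈e r∈f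
    ... | inj₂ refl | inj₂ v≡s  = r≢s v≡s

    corner : ∀ {v} → Inc v x₁ ⊎ Inc v x₂ → Inc v e ⊎ Inc v f
    corner (inj₁ v∈x₁) with on-x₁ v∈x₁
    ... | inj₁ refl = inj₁ p∈e
    ... | inj₂ refl = inj₂ r∈f
    corner (inj₂ v∈x₂) with on-x₂ v∈x₂
    ... | inj₁ refl = inj₁ q∈e
    ... | inj₂ refl = inj₂ s∈f

    on-e : ∀ {v} → Inc v e → Inc v x₁ ⊎ Inc v x₂
    on-e v∈e with inc-≡⊎≡ p∈e q∈e p≢q v∈e
    ... | inj₁ refl = inj₁ p∈x₁
    ... | inj₂ refl = inj₂ q∈x₂
    on-f : ∀ {v} → Inc v f → Inc v x₁ ⊎ Inc v x₂
    on-f v∈f with inc-≡⊎≡ r∈f s∈f r≢s v∈f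
    ... | inj₁ refl = inj₁ r∈x₁
    ... | inj₂ refl = inj₂ s∈x₂

    swapᵇ : Fin (m G) → Bool
    swapᵇ x = if does (x F.≟ e) ∨ does (x F.≟ f) then false
              else does (x F.≟ x₁) ∨ does (x F.≟ x₂) ∨ lookup P x

    swapped : Subset (m G)
    swapped = tabulate swapᵇ

    lookup-swapped : ∀ x → lookup swapped x ≡ swapᵇ x
    lookup-swapped = lookup∘tabulate swapᵇ

    e∉swapped : lookup swapped e ≡ false
    e∉swapped rewrite lookup-swapped e | dec-true (e F.≟ e) refl = refl
    f∉swapped : lookup swapped f ≡ false
    f∉swapped rewrite lookup-swapped f | dec-false (f F.≟ e) (≢-sym e≢f) | dec-true (f F.≟ f) refl = refl
    x₁∈swapped : x₁ ∈ swapped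
    x₁∈swapped = lookup⇒∈ (trans (lookup-swapped x₁) eq)
      where
      eq : swapᵇ x₁ ≡ true
      eq rewrite dec-false (x₁ F.≟ e) x₁≢e | dec-false (x₁ F.≟ f) x₁≢f
               | dec-true (x₁ F.≟ x₁) refl = refl
    x₂∈swapped : x₂ ∈ swapped
    x₂∈swapped = lookup⇒∈ (trans (lookup-swapped x₂) eq)
      where
      eq : swapᵇ x₂ ≡ true
      eq rewrite dec-false (x₂ F.≟ e) x₂≢e | dec-false (x₂ F.≟ f) x₂≢f
               | dec-true (x₂ F.≟ x₂) refl
               | ∨-zeroʳ (does (x₂ F.≟ x₁)) = refl
    swapped-elsewhere : ∀ {x} → x ≢ e → x ≢ f → x ≢ x₁ → x ≢ x₂ →
                        lookup swapped x ≡ lookup P x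
    swapped-elsewhere {x} x≢e x≢f x≢x₁ x≢x₂ rewrite lookup-swapped x
      | dec-false (x F.≟ e) x≢e | dec-false (x F.≟ f) x≢f
      | dec-false (x F.≟ x₁) x≢x₁ | dec-false (x F.≟ x₂) x≢x₂ = refl

    ∈swapped : ∀ {x} → x ∈ swapped → x ≡ x₁ ⊎ x ≡ x₂ ⊎ (x ≢ e × x ≢ f × x ∈ P)
    ∈swapped {x} x∈ with x F.≟ e | x F.≟ f | x F.≟ x₁ | x F.≟ x₂
    ... | yes refl | _ | _ | _ = ⊥-elim (true≢false (trans (sym ([]=⇒lookup x∈)) e∉swapped))
    ... | no _ | yes refl | _ | _ = ⊥-elim (true≢false (trans (sym ([]=⇒lookup x∈)) f∉swapped))
    ... | no _ | no _ | yes x≡x₁ | _ = inj₁ x≡x₁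
    ... | no _ | no _ | no _ | yes x≡x₂ = inj₂ (inj₁ x≡x₂)
    ... | no x≢e | no x≢f | no x≢x₁ | no x≢x₂ =
      inj₂ (inj₂ (x≢e , x≢f ,
        lookup⇒∈ (trans (sym (swapped-elsewhere x≢e x≢f x≢x₁ x≢x₂)) ([]=⇒lookup x∈))))

    unique-in-swapped : ∀ {v y} → (Inc v x₁ → y ≡ x₁) → (Inc v x₂ → y ≡ x₂) →
      (∀ {y′} → y′ ∈ P → y′ ≢ e → y′ ≢ f → Inc v y′ → y′ ≡ y) →
      ∀ y′ → y′ ∈ swapped → Inc v y′ → y′ ≡ y
    unique-in-swapped at-x₁ at-x₂ in-P y′ y′∈ vy′ with ∈swapped y′∈
    ... | inj₁ refl        = sym (at-x₁ vy′)
    ... | inj₂ (inj₁ refl) = sym (at-x₂ vy′)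
    ... | inj₂ (inj₂ (y′≢e , y′≢f , y′∈P)) = in-P y′∈P y′≢e y′≢f vy′

    corner-P-edge : ∀ {v y′} → Inc v x₁ ⊎ Inc v x₂ →
                    y′ ∈ P → y′ ≢ e → y′ ≢ f → Inc v y′ → ⊥
    corner-P-edge v∈x y′∈P y′≢e y′≢f vy′ with corner v∈x
    ... | inj₁ ve = y′≢e (pm-unique pmP y′∈P e∈P vy′ ve)
    ... | inj₂ vf = y′≢f (pm-unique pmP y′∈P f∈P vy′ vf)

    swapped-pm : PerfectMatching G swapped
    swapped-pm v with inc? v x₁ | inc? v x₂
    ... | yes v∈x₁ | _ = x₁ , x₁∈swapped , v∈x₁ ,
      unique-in-swapped (λ _ → refl) (⊥-elim ∘ not-on-both v∈x₁)
        (λ y′∈P y′≢e y′≢f → ⊥-elim ∘ corner-P-edge (inj₁ v∈x₁) y′∈P y′≢e y′≢f)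
    ... | no v∉x₁ | yes v∈x₂ = x₂ , x₂∈swapped , v∈x₂ ,
      unique-in-swapped (⊥-elim ∘ v∉x₁) (λ _ → refl)
        (λ y′∈P y′≢e y′≢f → ⊥-elim ∘ corner-P-edge (inj₂ v∈x₂) y′∈P y′≢e y′≢f)
    ... | no v∉x₁ | no v∉x₂ = y , y∈swapped , vy ,
      unique-in-swapped (⊥-elim ∘ v∉x₁) (⊥-elim ∘ v∉x₂)
        (λ y′∈P _ _ vy′ → pm-unique pmP y′∈P y∈P vy′ vy)
      where
      y = proj₁ (pmP v)
      y∈P = proj₁ (proj₂ (pmP v))
      vy = proj₁ (proj₂ (proj₂ (pmP v)))
      not-corner : Inc v x₁ ⊎ Inc v x₂ → ⊥
      not-corner (inj₁ v∈x₁) = v∉x₁ v∈x₁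
      not-corner (inj₂ v∈x₂) = v∉x₂ v∈x₂
      y∈swapped : y ∈ swapped
      y∈swapped = lookup⇒∈ (trans
        (swapped-elsewhere (λ { refl → not-corner (on-e vy) }) (λ { refl → not-corner (on-f vy) })
                           (λ { refl → v∉x₁ vy }) (λ { refl → v∉x₂ vy }))
        ([]=⇒lookup y∈P))

  module _ {M : Subset (m G)} (pm : PerfectMatching G M) where

    cover : Fin N → Fin (m G)
    cover v = proj₁ (pm v)

    cover-∈ : ∀ v → cover v ∈ M
    cover-∈ v = proj₁ (proj₂ (pm v))

    cover-inc : ∀ v → Inc v (cover v)
    cover-inc v = proj₁ (proj₂ (proj₂ (pm v)))

    cover-unique : ∀ {a e} → e ∈ M → Inc a e → cover a ≡ e
    cover-unique e∈M ae = pm-unique pm (cover-∈ _) e∈M (cover-inc _) ae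

    cover-ends : ∀ {a e} → cover a ≡ e → a ≡ fst e ⊎ a ≡ snd e
    cover-ends refl = cover-inc _

    cover-indicator : ∀ {e} → e ∈ M → ∀ a →
      [ does (cover a F.≟ e) ] ≡ [ does (a F.≟ fst e) ] + [ does (a F.≟ snd e) ]
    cover-indicator {e} e∈M a with a F.≟ fst e
    ... | yes refl rewrite dec-true (cover a F.≟ e) (cover-unique e∈M (inj₁ refl))
                         | dec-false (a F.≟ snd e) (fst≢snd e) = refl
    ... | no a≢fst with a F.≟ snd e
    ...   | yes refl rewrite dec-true (cover a F.≟ e) (cover-unique e∈M (inj₂ refl)) = refl
    ...   | no a≢snd
      rewrite dec-false (cover a F.≟ e) λ cover≡e → [ a≢fst , a≢snd ]′ (cover-ends cover≡e) = refl

    count-cover : ∀ {e} → e ∈ M → count (λ a → does (cover a F.≟ e)) ≡ 2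
    count-cover {e} e∈M = trans (∑-cong (cover-indicator e∈M))
      (trans (∑-+ (λ a → [ does (a F.≟ fst e) ]) (λ a → [ does (a F.≟ snd e) ]))
             (cong₂ _+_ (count-≟ (fst e)) (count-≟ (snd e))))

    ∣M∣+∣M∣≡N : ∣ M ∣ + ∣ M ∣ ≡ N
    ∣M∣+∣M∣≡N = begin
      ∣ M ∣ + ∣ M ∣
        ≡⟨ cong₂ _+_ (∣p∣≡count M) (∣p∣≡count M) ⟩
      count (lookup M) + count (lookup M)
        ≡⟨ ∑-+ ([_] ∘ lookup M) ([_] ∘ lookup M) ⟨
      ∑ (λ e → [ lookup M e ] + [ lookup M e ])
        ≡⟨ ∑-cong (λ e → doubled e (lookup M e) refl) ⟩
      ∑ (λ e → count (λ a → does (cover a F.≟ e)))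
        ≡⟨ ∑-swap (λ e a → [ does (cover a F.≟ e) ]) ⟩
      ∑ (λ a → count (λ e → does (cover a F.≟ e)))
        ≡⟨ ∑-cong (count-≟′ ∘ cover) ⟩
      ∑ {N} (λ _ → 1)
        ≡⟨ ∑-one N ⟩
      N ∎
      where
      open ≡-Reasoning
      doubled : ∀ e b → lookup M e ≡ b → [ b ] + [ b ] ≡ count (λ a → does (cover a F.≟ e))
      doubled e true  Me = sym (count-cover (lookup⇒∈ Me))
      doubled e false Me = sym (trans (∑-cong (λ a → cong [_] (dec-false (cover a F.≟ e)
        λ { refl → true≢false (trans (sym ([]=⇒lookup (cover-∈ a))) Me) }))) (∑-zero N))

    -- Ranked anti-forcing sets

    InjectiveOnM : (Fin (m G) → ℕ) → Set
    InjectiveOnM ρ = ∀ {g h} → g ∈ M → h ∈ M → ρ g ≡ ρ h → g ≡ h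

    fst-injective : ∀ {x y} → x ∈ M → y ∈ M → fst x ≡ fst y → x ≡ y
    fst-injective x∈M y∈M fst≡ =
      trans (sym (cover-unique x∈M (inj₁ refl))) (trans (cong cover fst≡) (cover-unique y∈M (inj₁ refl)))

    module Ranked (ρ : Fin (m G) → ℕ) (ρ-inj : InjectiveOnM ρ) where

      rank : Fin N → ℕ
      rank a = ρ (cover a)

      rank-inj : ∀ {a b} → rank a ≡ rank b → cover a ≡ cover b
      rank-inj = ρ-inj (cover-∈ _) (cover-∈ _)

      ≡rank⇒∈M : ∀ {a b x} → a ≢ b → Inc a x → Inc b x → rank a ≡ rank b → x ∈ M
      ≡rank⇒∈M {a} {b} a≢b ax bx ra≡rb = subst (_∈ M)
        (edge-unique a≢b (cover-inc a) (subst (Inc b) (sym (rank-inj ra≡rb)) (cover-inc b)) ax bx)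
        (cover-∈ a)

      low high : Fin (m G) → Fin N
      low x with rank (fst x) <? rank (snd x)
      ... | yes _ = fst x
      ... | no  _ = snd x
      high x with rank (fst x) <? rank (snd x)
      ... | yes _ = snd x
      ... | no  _ = fst x

      low<high : ∀ {x} → x ∉ M → rank (low x) < rank (high x)
      low<high {x} x∉M with rank (fst x) <? rank (snd x)
      ... | yes fst<snd = fst<snd
      ... | no  fst≮snd = ≤∧≢⇒< (≮⇒≥ fst≮snd) λ snd≡fst →
                            x∉M (≡rank⇒∈M (fst≢snd x) (inj₁ refl) (inj₂ refl) (sym snd≡fst))

      low-inc : ∀ x → Inc (low x) x
      low-inc x with rank (fst x) <? rank (snd x)
      ... | yes _ = inj₁ refl
      ... | no  _ = inj₂ refl

      high-inc : ∀ x → Inc (high x) x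
      high-inc x with rank (fst x) <? rank (snd x)
      ... | yes _ = inj₂ refl
      ... | no  _ = inj₁ refl

      low-of-< : ∀ {u w x} → Inc u x → Inc w x → rank u < rank w → low x ≡ u
      low-of-< {u} {w} {x} ux wx u<w
        with rank (fst x) <? rank (snd x) | ends ux wx (λ { refl → <-irrefl refl u<w })
      ... | yes _       | inj₁ (refl , _)   = refl
      ... | yes fst<snd | inj₂ (refl , refl) = ⊥-elim (<-asym u<w fst<snd)
      ... | no  fst≮snd | inj₁ (refl , refl) = ⊥-elim (fst≮snd u<w)
      ... | no  _       | inj₂ (refl , _)   = refl

      module Labelled (c : Fin (m G) → Bool) where

        chosen : Fin (m G) → Fin N
        chosen g = if c g then snd g else fst g

        chosen-inc : ∀ g → Inc (chosen g) g
        chosen-inc g with c g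
        ... | true  = inj₂ refl
        ... | false = inj₁ refl

        cover-chosen : ∀ {g} → g ∈ M → cover (chosen g) ≡ g
        cover-chosen g∈M = cover-unique g∈M (chosen-inc _)

        -- Written with xor so that the labelling by not ∘ c is the complement of the one by c.
        labelled : Fin N → Bool
        labelled a = does (a F.≟ fst (cover a)) xor c (cover a)

        labelled-chosen : ∀ {g} → g ∈ M → labelled (chosen g) ≡ true
        labelled-chosen {g} g∈M rewrite cover-chosen g∈M with c g
        ... | true  rewrite dec-false (snd g F.≟ fst g) (≢-sym (fst≢snd g)) = refl
        ... | false rewrite dec-true (fst g F.≟ fst g) refl = refl

        labelled⇒chosen : ∀ {a} → labelled a ≡ true → a ≡ chosen (cover a)
        labelled⇒chosen {a} la with cover a | cover-inc a
        ... | g | a∈g with c g | a∈g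
        ...   | false | inj₁ refl = refl
        ...   | true  | inj₂ refl = refl
        ...   | true  | inj₁ refl rewrite dec-true (fst g F.≟ fst g) refl = ⊥-elim (true≢false (sym la))
        ...   | false | inj₂ refl rewrite dec-false (snd g F.≟ fst g) (≢-sym (fst≢snd g)) =
          ⊥-elim (true≢false (sym la))

        Tᵇ : Fin (m G) → Bool
        Tᵇ x = not (lookup M x) ∧ labelled (low x)

        T : Subset (m G)
        T = tabulate Tᵇ

        ∈T⇒ : ∀ {x} → x ∈ T → x ∉ M × labelled (low x) ≡ true
        ∈T⇒ {x} x∈T with lookup M x in Mx | trans (sym (lookup∘tabulate Tᵇ x)) ([]=⇒lookup x∈T)
        ... | false | lx = (λ x∈M → true≢false (trans (sym ([]=⇒lookup x∈M)) Mx)) , lx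

        ∈T : ∀ {x u w} → x ∉ M → Inc u x → Inc w x → rank u < rank w →
             labelled u ≡ true → x ∈ T
        ∈T {x} x∉M ux wx u<w lu = lookup⇒∈ (trans (lookup∘tabulate Tᵇ x)
          (cong₂ _∧_ (cong not (∉⇒lookup x∉M)) (trans (cong labelled (low-of-< ux wx u<w)) lu)))

        module _ {P} (pmP : PerfectMatching G P) (P-avoids-T : ∀ x → x ∈ P → x ∉ T) where

          -- The P-edge at the labelled end ℓ of cover v lies in M: towards a higher rank it would be
          -- in T, towards a lower-ranked w it would meet cover w, already in P.
          covered : ∀ n v → rank v < n → cover v ∈ P
          covered (suc n) v rv≤n =
            subst (_∈ P) (trans (sym (cover-unique y∈M ℓy)) (cover-chosen g∈M)) y∈P
            where
            g∈M = cover-∈ v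
            ℓ = chosen (cover v)
            y = proj₁ (pmP ℓ)
            y∈P = proj₁ (proj₂ (pmP ℓ))
            ℓy = proj₁ (proj₂ (proj₂ (pmP ℓ)))
            rℓ≡rv : rank ℓ ≡ rank v
            rℓ≡rv = cong ρ (cover-chosen g∈M)
            y∈M : y ∈ M
            y∈M with y ∈? M | other-end ℓy
            ... | yes y∈M | _ = y∈M
            ... | no  y∉M | w , wy , ℓ≢w with <-cmp (rank ℓ) (rank w)
            ...   | tri< ℓ<w _ _ =
              ⊥-elim (P-avoids-T y y∈P (∈T y∉M ℓy wy ℓ<w (labelled-chosen g∈M)))
            ...   | tri≈ _ ℓ≡w _ = ⊥-elim (y∉M (≡rank⇒∈M ℓ≢w ℓy wy ℓ≡w))
            ...   | tri> _ _ w<ℓ = subst (_∈ M) (pm-unique pmP w-covered y∈P (cover-inc w) wy) (cover-∈ w)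
              where
              w-covered = covered n w (<-≤-trans w<ℓ (subst (_≤ n) (sym rℓ≡rv) (≤-pred rv≤n)))

          all-covered : ∀ v → cover v ∈ P
          all-covered v = covered (suc (rank v)) v ≤-refl

          ≡M : P ≡ M
          ≡M = ⊆-antisym P⊆M M⊆P
            where
            P⊆M : P ⊆ M
            P⊆M {x} x∈P = subst (_∈ M)
              (pm-unique pmP (all-covered (fst x)) x∈P (cover-inc _) (inj₁ refl)) (cover-∈ (fst x))
            M⊆P : M ⊆ P
            M⊆P {x} x∈M = subst (_∈ P) (cover-unique x∈M (inj₁ refl)) (all-covered (fst x))

        anti-forcing : AntiForcingSet G M T
        anti-forcing = (λ x∈T → x∉p⇒x∈∁p (proj₁ (∈T⇒ x∈T))) ,
                       M , (pm , λ x x∈M x∈T → proj₁ (∈T⇒ x∈T) x∈M) ,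
                       λ P (pmP , P-avoids-T) → ≡M pmP P-avoids-T

      complementary-sizes : ∀ c → ∣ Labelled.T c ∣ + ∣ Labelled.T (not ∘ c) ∣ ≡ m G ∸ ∣ M ∣
      complementary-sizes c = begin
        ∣ A.T ∣ + ∣ B.T ∣
          ≡⟨ cong₂ _+_ (∣tabulate∣≡count A.Tᵇ) (∣tabulate∣≡count B.Tᵇ) ⟩
        ∑ ([_] ∘ A.Tᵇ) + ∑ ([_] ∘ B.Tᵇ)
          ≡⟨ ∑-+ ([_] ∘ A.Tᵇ) ([_] ∘ B.Tᵇ) ⟨
        ∑ (λ x → [ A.Tᵇ x ] + [ B.Tᵇ x ])
          ≡⟨ ∑-cong split ⟩
        count (not ∘ lookup M)
          ≡⟨ ∑-cong (λ x → cong [_] (lookup-map x not M)) ⟨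
        count (lookup (∁ M))
          ≡⟨ ∣p∣≡count (∁ M) ⟨
        ∣ ∁ M ∣
          ≡⟨ ∣∁p∣≡n∸∣p∣ M ⟩
        m G ∸ ∣ M ∣ ∎
        where
        open ≡-Reasoning
        module A = Labelled c
        module B = Labelled (not ∘ c)
        split : ∀ x → [ A.Tᵇ x ] + [ B.Tᵇ x ] ≡ [ not (lookup M x) ]
        split x rewrite sym (not-distribʳ-xor (does (low x F.≟ fst (cover (low x)))) (c (cover (low x)))) =
          [∧]+[∧not] (not (lookup M x)) (A.labelled (low x))

    -- Separating sets relative to a vertex set

    FixedOutside : (Fin N → Bool) → Subset (m G) → Set
    FixedOutside W P = ∀ a → W a ≡ false → cover a ∈ P

    Agree : Subset (m G) → Subset (m G) → (Fin (m G) → Bool) → Set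
    Agree P Q X = ∀ x → lookup P x ∧ X x ≡ lookup Q x ∧ X x

    Separates : (Fin N → Bool) → (Fin (m G) → Bool) → Set
    Separates W X = ∀ P Q → PerfectMatching G P → PerfectMatching G Q →
                    FixedOutside W P → FixedOutside W Q → Agree P Q X → P ≡ Q

    inside : (Fin N → Bool) → Fin (m G) → Bool
    inside W x = W (fst x) ∧ W (snd x)

    countInside : (Fin (m G) → Bool) → (Fin N → Bool) → ℕ
    countInside X W = count (λ x → X x ∧ inside W x)

    Closed : (Fin N → Bool) → Set
    Closed W = ∀ a b → cover a ≡ cover b → W a ≡ W b

    inside-false : ∀ W {a x} → Inc a x → W a ≡ false → inside W x ≡ false
    inside-false W {x = x} (inj₁ refl) Wa rewrite Wa = refl
    inside-false W {x = x} (inj₂ refl) Wa rewrite Wa = ∧-zeroʳ (W (fst x))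

    inside-true : ∀ W {a b x} → Inc a x → Inc b x → a ≢ b →
                  W a ≡ true → W b ≡ true → inside W x ≡ true
    inside-true W ax bx a≢b Wa Wb with ends ax bx a≢b
    ... | inj₁ (refl , refl) rewrite Wa | Wb = refl
    ... | inj₂ (refl , refl) rewrite Wa | Wb = refl

    module Tight (k : ℕ) (af-lower : ∀ S → AntiForcingSet G M S → k ≤ ∣ S ∣)
                 (excess : m G ∸ ∣ M ∣ ≡ k + k) where

      ranked-size-≤ : ∀ ρ (ρ-inj : InjectiveOnM ρ) c → ∣ Ranked.Labelled.T ρ ρ-inj c ∣ ≤ k
      ranked-size-≤ ρ ρ-inj c = +-cancelʳ-≤ k ∣ A.T ∣ k
        (≤-trans (+-monoʳ-≤ ∣ A.T ∣ (af-lower B.T B.anti-forcing))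
                 (≤-reflexive (trans (complementary-sizes c) excess)))
        where
        open Ranked ρ ρ-inj
        module A = Labelled c
        module B = Labelled (not ∘ c)

      ranked-minimal : ∀ ρ (ρ-inj : InjectiveOnM ρ) c {S} → AntiForcingSet G M S →
                       ¬ (S ⊂ Ranked.Labelled.T ρ ρ-inj c)
      ranked-minimal ρ ρ-inj c S-af S⊂T =
        <⇒≱ (<-≤-trans (p⊂q⇒∣p∣<∣q∣ S⊂T) (ranked-size-≤ ρ ρ-inj c)) (af-lower _ S-af)

      module _ {g h} (g∈M : g ∈ M) (h∈M : h ∈ M) (g≢h : g ≢ h) where

        top-rank : Fin (m G) → ℕ
        top-rank x with x F.≟ g | x F.≟ h
        ... | yes _ | _     = N
        ... | no _  | yes _ = suc N
        ... | no _  | no _  = toℕ (fst x)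

        top-rank-view : ∀ x → (x ≡ g × top-rank x ≡ N) ⊎ (x ≡ h × top-rank x ≡ suc N) ⊎
                              (x ≢ g × x ≢ h × top-rank x ≡ toℕ (fst x))
        top-rank-view x with x F.≟ g | x F.≟ h
        ... | yes x≡g | _       = inj₁ (x≡g , refl)
        ... | no _    | yes x≡h = inj₂ (inj₁ (x≡h , refl))
        ... | no x≢g  | no x≢h  = inj₂ (inj₂ (x≢g , x≢h , refl))

        toℕ-fst≢ : ∀ x {n} → N ≤ n → toℕ (fst x) ≢ n
        toℕ-fst≢ x N≤n toℕ≡n = <⇒≱ (FP.toℕ<n (fst x)) (subst (N ≤_) (sym toℕ≡n) N≤n)

        top-rank-inj : InjectiveOnM top-rank
        top-rank-inj {x} {y} x∈M y∈M ρx≡ρy with top-rank-view x | top-rank-view y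
        ... | inj₁ (refl , _) | inj₁ (refl , _) = refl
        ... | inj₂ (inj₁ (refl , _)) | inj₂ (inj₁ (refl , _)) = refl
        ... | inj₂ (inj₂ (_ , _ , ρx)) | inj₂ (inj₂ (_ , _ , ρy)) =
          fst-injective x∈M y∈M (FP.toℕ-injective (trans (sym ρx) (trans ρx≡ρy ρy)))
        ... | inj₁ (_ , ρx) | inj₂ (inj₁ (_ , ρy)) =
          ⊥-elim (1+n≢n (trans (sym ρy) (trans (sym ρx≡ρy) ρx)))
        ... | inj₂ (inj₁ (_ , ρx)) | inj₁ (_ , ρy) =
          ⊥-elim (1+n≢n (trans (sym ρx) (trans ρx≡ρy ρy)))
        ... | inj₁ (_ , ρx) | inj₂ (inj₂ (_ , _ , ρy)) =
          ⊥-elim (toℕ-fst≢ y ≤-refl (trans (sym ρy) (trans (sym ρx≡ρy) ρx)))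
        ... | inj₂ (inj₁ (_ , ρx)) | inj₂ (inj₂ (_ , _ , ρy)) =
          ⊥-elim (toℕ-fst≢ y (n≤1+n N) (trans (sym ρy) (trans (sym ρx≡ρy) ρx)))
        ... | inj₂ (inj₂ (_ , _ , ρx)) | inj₁ (_ , ρy) =
          ⊥-elim (toℕ-fst≢ x ≤-refl (trans (sym ρx) (trans ρx≡ρy ρy)))
        ... | inj₂ (inj₂ (_ , _ , ρx)) | inj₂ (inj₁ (_ , ρy)) =
          ⊥-elim (toℕ-fst≢ x (n≤1+n N) (trans (sym ρx) (trans ρx≡ρy ρy)))

        top-rank-g : top-rank g ≡ N
        top-rank-g with top-rank-view g
        ... | inj₁ (_ , ρg) = ρg
        ... | inj₂ (inj₁ (g≡h , _)) = ⊥-elim (g≢h g≡h)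
        ... | inj₂ (inj₂ (g≢g , _)) = ⊥-elim (g≢g refl)

        top-rank-h : top-rank h ≡ suc N
        top-rank-h with top-rank-view h
        ... | inj₁ (h≡g , _) = ⊥-elim (g≢h (sym h≡g))
        ... | inj₂ (inj₁ (_ , ρh)) = ρh
        ... | inj₂ (inj₂ (_ , h≢h , _)) = ⊥-elim (h≢h refl)

        above-g⇒h : ∀ {x} → N < top-rank x → x ≡ h
        above-g⇒h {x} N<ρx with top-rank-view x
        ... | inj₁ (_ , ρx) = ⊥-elim (<-irrefl (sym ρx) N<ρx)
        ... | inj₂ (inj₁ (x≡h , _)) = x≡h
        ... | inj₂ (inj₂ (_ , _ , ρx)) = ⊥-elim (<-asym N<ρx (subst (_< N) (sym ρx) (FP.toℕ<n (fst x))))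

        open Ranked top-rank top-rank-inj

        selecting : Fin N → Fin (m G) → Bool
        selecting v x = does (x F.≟ g) ∧ does (v F.≟ snd g)

        selected : ∀ {v} → Inc v g → Labelled.chosen (selecting v) g ≡ v
        selected {v} v∈g rewrite dec-true (g F.≟ g) refl with v F.≟ snd g
        ... | yes v≡snd = sym v≡snd
        ... | no v≢snd = [ sym , (λ v≡snd → ⊥-elim (v≢snd v≡snd)) ]′ v∈g

        selecting-elsewhere : ∀ {v w a} → cover a ≢ g →
                              Labelled.labelled (selecting v) a ≡ Labelled.labelled (selecting w) a
        selecting-elsewhere {a = a} a≁g rewrite dec-false (cover a F.≟ g) a≁g = refl

        module _ {ν ε} (ν∈g : Inc ν g) (ε∈g : Inc ε g) (ν≢ε : ν ≢ ε) (ε≁h : ¬ AdjTo ε h) where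

          module A = Labelled (selecting ν)
          module C = Labelled (selecting ε)

          -- Moving the label of g from ε to ν can only remove from T an edge with lower end ε; its
          -- upper end, ranked above g, would lie on h.
          C⊆A : C.T ⊆ A.T
          C⊆A {x} x∈C with C.∈T⇒ x∈C | cover (low x) F.≟ g
          ... | x∉M , lab | no low≁g = A.∈T x∉M (low-inc x) (high-inc x) (low<high x∉M)
                                          (trans (selecting-elsewhere {ν} {ε} low≁g) lab)
          ... | x∉M , lab | yes low∈g = ⊥-elim (ε≁h (high x , subst (Inc (high x)) high∈h (cover-inc (high x)) ,
                                         x , subst (λ v → Inc v x) low≡ε (low-inc x) , high-inc x))
            where
            low≡ε : low x ≡ ε
            low≡ε = trans (C.labelled⇒chosen lab) (trans (cong C.chosen low∈g) (selected ε∈g))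
            high∈h : cover (high x) ≡ h
            high∈h = above-g⇒h
              (subst (_< rank (high x)) (trans (cong top-rank low∈g) top-rank-g) (low<high x∉M))

          strictly-above : AdjTo ν h → C.T ⊂ A.T
          strictly-above (t , t∈h , z , ν∈z , t∈z) = C⊆A , z , z∈A , z∉C
            where
            cover-ν : cover ν ≡ g
            cover-ν = cover-unique g∈M ν∈g
            cover-t : cover t ≡ h
            cover-t = cover-unique h∈M t∈h
            z∉M : z ∉ M
            z∉M z∈M = g≢h (trans (sym cover-ν)
                            (trans (cover-unique z∈M ν∈z) (trans (sym (cover-unique z∈M t∈z)) cover-t)))
            ν<t : rank ν < rank t
            ν<t = subst₂ _<_ (sym (trans (cong top-rank cover-ν) top-rank-g))
                             (sym (trans (cong top-rank cover-t) top-rank-h)) ≤-refl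
            z∈A : z ∈ A.T
            z∈A = A.∈T z∉M ν∈z t∈z ν<t
                    (subst (λ v → A.labelled v ≡ true) (selected ν∈g) (A.labelled-chosen g∈M))
            z∉C : z ∉ C.T
            z∉C z∈C = ν≢ε (begin
              ν                         ≡⟨ low-of-< ν∈z t∈z ν<t ⟨
              low z                     ≡⟨ C.labelled⇒chosen (proj₂ (C.∈T⇒ z∈C)) ⟩
              C.chosen (cover (low z))  ≡⟨ cong (C.chosen ∘ cover) (low-of-< ν∈z t∈z ν<t) ⟩
              C.chosen (cover ν)        ≡⟨ cong C.chosen cover-ν ⟩
              C.chosen g                ≡⟨ selected ε∈g ⟩
              ε                         ∎)
              where open ≡-Reasoning

        adjacency-transfers : ∀ {ν ε} → Inc ν g → Inc ε g → ν ≢ ε → AdjTo ν h → AdjTo ε h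
        adjacency-transfers {ν} {ε} ν∈g ε∈g ν≢ε ν~h with adjTo? ε h
        ... | yes ε~h = ε~h
        ... | no  ε≁h = ⊥-elim (ranked-minimal top-rank top-rank-inj (selecting ν)
                                  (C.anti-forcing ν∈g ε∈g ν≢ε ε≁h) (strictly-above ν∈g ε∈g ν≢ε ε≁h ν~h))

      adjTo-ends : ∀ {a e f} → e ∈ M → f ∈ M → e ≢ f → Inc a e → AdjTo a f →
                   ∀ {v} → Inc v e → AdjTo v f
      adjTo-ends {a} e∈M f∈M e≢f a∈e a~f {v} v∈e with a F.≟ v
      ... | yes refl = a~f
      ... | no a≢v  = adjacency-transfers e∈M f∈M e≢f a∈e v∈e a≢v a~f

      alternating-square : ∀ {a b} → cover a ≢ cover b → Adj a b → AlternatingSquare (cover a) (cover b)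
      alternating-square {a} {b} e≢f a~b
        with adjTo-ends (cover-∈ a) (cover-∈ b) e≢f (cover-inc a) (b , cover-inc b , a~b)
      ... | p~f with p~f (inj₁ refl) | p~f (inj₂ refl)
      ...   | r , r∈f , p~r | t , t∈f , q~t with other-end r∈f
      ...     | s , s∈f , r≢s
                with inc-≡⊎≡ r∈f s∈f r≢s t∈f
                   | adjTo-ends (cover-∈ b) (cover-∈ a) (≢-sym e≢f) (cover-inc b)
                                (a , cover-inc a , adj-sym a~b) s∈f
      ... | inj₂ refl | _ = square (inj₁ refl) (inj₂ refl) p≢q r∈f s∈f r≢s p~r q~t
        where p≢q = fst≢snd (cover a)
      ... | inj₁ refl | u , u∈e , s~u with inc-≡⊎≡ (inj₁ refl) (inj₂ refl) (fst≢snd (cover a)) u∈e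
      ...   | inj₁ refl =
        square (inj₁ refl) (inj₂ refl) (fst≢snd (cover a)) s∈f r∈f (≢-sym r≢s) (adj-sym s~u) q~t
      ...   | inj₂ refl =
        square (inj₁ refl) (inj₂ refl) (fst≢snd (cover a)) r∈f s∈f r≢s p~r (adj-sym s~u)

      Bound : (Fin N → Bool) → ℕ → Set
      Bound W j = ∀ X → Separates W X → j ≤ countInside X W

      module Grow (W : Fin N → Bool) (closed : Closed W) {z w y} (Wz : W z ≡ false) (Ww : W w ≡ true)
                  (zy : Inc z y) (wy : Inc w y) where

        e f : Fin (m G)
        e = cover z
        f = cover w

        e≢f : e ≢ f
        e≢f e≡f = true≢false (trans (sym Ww) (trans (closed w z (sym e≡f)) Wz))

        sq : AlternatingSquare e f
        sq = alternating-square e≢f (y , zy , wy)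
        open AlternatingSquare sq

        W′ : Fin N → Bool
        W′ a = W a ∨ does (cover a F.≟ e)

        W⊆W′ : ∀ {a} → W a ≡ true → W′ a ≡ true
        W⊆W′ Wa rewrite Wa = refl

        outside-W′ : ∀ {a} → W′ a ≡ false → W a ≡ false × cover a ≢ e
        outside-W′ {a} W′a with W a | cover a F.≟ e
        ... | false | no a∉e = refl , a∉e

        closed′ : Closed W′
        closed′ a b cover≡ = cong₂ _∨_ (closed a b cover≡) (cong (λ g → does (g F.≟ e)) cover≡)

        count-W′ : count W′ ≡ count W + 2
        count-W′ = trans (∑-cong split) (trans (∑-+ ([_] ∘ W) (λ a → [ does (cover a F.≟ e) ]))
                                               (cong (count W +_) (count-cover (cover-∈ z))))
          where
          split : ∀ a → [ W′ a ] ≡ [ W a ] + [ does (cover a F.≟ e) ]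
          split a with W a in Wa | cover a F.≟ e
          ... | false | _        = refl
          ... | true  | no _     = refl
          ... | true  | yes a∈e = ⊥-elim (true≢false (trans (sym Wa) (trans (closed a z a∈e) Wz)))

        W-on-e : ∀ {a} → Inc a e → W a ≡ false
        W-on-e a∈e = trans (closed _ z (cover-unique (cover-∈ z) a∈e)) Wz
        W-on-f : ∀ {a} → Inc a f → W a ≡ true
        W-on-f a∈f = trans (closed _ w (cover-unique (cover-∈ w) a∈f)) Ww
        W′-on-e : ∀ {a} → Inc a e → W′ a ≡ true
        W′-on-e {a} a∈e
          rewrite W-on-e a∈e | dec-true (cover a F.≟ e) (cover-unique (cover-∈ z) a∈e) = refl
        W′-on-f : ∀ {a} → Inc a f → W′ a ≡ true
        W′-on-f a∈f = W⊆W′ (W-on-f a∈f)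

        inside-mono : ∀ x → inside W x ≡ true → inside W′ x ≡ true
        inside-mono x in-x with W (fst x) | W (snd x)
        inside-mono x refl | true | true = refl

        module SwapM = Swap pm (cover-∈ z) (cover-∈ w) e≢f sq

        x₁∉M : x₁ ∉ M
        x₁∉M x₁∈M =
          SwapM.x₁≢e (trans (sym (cover-unique x₁∈M p∈x₁)) (cover-unique (cover-∈ z) p∈e))
        x₂∉M : x₂ ∉ M
        x₂∉M x₂∈M =
          SwapM.x₂≢e (trans (sym (cover-unique x₂∈M q∈x₂)) (cover-unique (cover-∈ z) q∈e))

        fixed-lift : ∀ {P} → FixedOutside W P → FixedOutside W′ P
        fixed-lift fixP a W′a = fixP a (proj₁ (outside-W′ W′a))

        separates-shrink : ∀ {X} → Separates W′ X → Separates W X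
        separates-shrink sep′ P Q pmP pmQ fixP fixQ = sep′ P Q pmP pmQ (fixed-lift fixP) (fixed-lift fixQ)

        module _ {P} (pmP : PerfectMatching G P) (e∈P : e ∈ P) (f∈P : f ∈ P) where
          open Swap pmP e∈P f∈P e≢f sq

          swapped-fixed : FixedOutside W P → FixedOutside W′ swapped
          swapped-fixed fixP a W′a =
            lookup⇒∈ (trans (swapped-elsewhere a≁e a≁f a≁x₁ a≁x₂) ([]=⇒lookup (fixP a Wa)))
            where
            Wa = proj₁ (outside-W′ W′a)
            a≁e = proj₂ (outside-W′ W′a)
            a≁f : cover a ≢ f
            a≁f a∈f = true≢false (trans (sym Ww) (trans (closed w a (sym a∈f)) Wa))
            a≁x₁ : cover a ≢ x₁
            a≁x₁ a∈x₁ = x₁∉M (subst (_∈ M) a∈x₁ (cover-∈ a))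
            a≁x₂ : cover a ≢ x₂
            a≁x₂ a∈x₂ = x₂∉M (subst (_∈ M) a∈x₂ (cover-∈ a))

          swapped-agrees : ∀ {Q X} → X e ≡ false → X x₁ ≡ false → X x₂ ≡ false →
                           lookup Q f ∧ X f ≡ false →
                           (∀ x → x ≢ f → lookup P x ∧ X x ≡ lookup Q x ∧ X x) → Agree swapped Q X
          swapped-agrees {Q} {X} Xe Xx₁ Xx₂ Qf agree-off-f x
            with x F.≟ e | x F.≟ f | x F.≟ x₁ | x F.≟ x₂
          ... | yes refl | _ | _ | _ rewrite Xe = trans (∧-zeroʳ _) (sym (∧-zeroʳ _))
          ... | no _ | yes refl | _ | _ rewrite f∉swapped = sym Qf
          ... | no _ | no _ | yes refl | _ rewrite Xx₁ = trans (∧-zeroʳ _) (sym (∧-zeroʳ _))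
          ... | no _ | no _ | no _ | yes refl rewrite Xx₂ = trans (∧-zeroʳ _) (sym (∧-zeroʳ _))
          ... | no x≢e | no x≢f | no x≢x₁ | no x≢x₂
            rewrite swapped-elsewhere x≢e x≢f x≢x₁ x≢x₂ = agree-off-f x x≢f

          swapped-≢ : ∀ {Q} → e ∈ Q → swapped ≢ Q
          swapped-≢ e∈Q refl = true≢false (trans (sym ([]=⇒lookup e∈Q)) e∉swapped)

        fixed-M : FixedOutside W M
        fixed-M a _ = cover-∈ a

        module _ {X} (sep′ : Separates W′ X)
                 (Xe : X e ≡ false) (Xx₁ : X x₁ ≡ false) (Xx₂ : X x₂ ≡ false) where

          f-separating : X f ≡ true
          f-separating with X f in Xf
          ... | true  = refl
          ... | false = ⊥-elim (swapped-≢ pm (cover-∈ z) (cover-∈ w) (cover-∈ z)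
                          (sep′ _ M SwapM.swapped-pm pm
                            (swapped-fixed pm (cover-∈ z) (cover-∈ w) fixed-M) (fixed-lift fixed-M)
                            (swapped-agrees pm (cover-∈ z) (cover-∈ w) {M} Xe Xx₁ Xx₂
                              (trans (cong (lookup M f ∧_) Xf) (∧-zeroʳ _)) (λ _ _ → refl))))

          agree-off-f : ∀ {P Q} → Agree P Q (X without f) →
                        ∀ x → x ≢ f → lookup P x ∧ X x ≡ lookup Q x ∧ X x
          agree-off-f agree x x≢f with agree x
          ... | eq rewrite dec-false (x F.≟ f) x≢f = eq

          mismatch : ∀ {P Q} → PerfectMatching G P → PerfectMatching G Q →
                     FixedOutside W P → FixedOutside W Q →
                     lookup P f ≡ true → lookup Q f ≡ false → Agree P Q (X without f) → ⊥
          mismatch {P} {Q} pmP pmQ fixP fixQ Pf Qf agree = swapped-≢ pmP e∈P f∈P (fixQ z Wz)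
            (sep′ _ Q (Swap.swapped-pm pmP e∈P f∈P e≢f sq) pmQ
              (swapped-fixed pmP e∈P f∈P fixP) (fixed-lift fixQ)
              (swapped-agrees pmP e∈P f∈P {Q} Xe Xx₁ Xx₂ (cong (_∧ X f) Qf) (agree-off-f {P} {Q} agree)))
            where
            e∈P = fixP z Wz
            f∈P = lookup⇒∈ Pf

          agree-at-f : ∀ {P Q} → Agree P Q (X without f) → lookup P f ≡ lookup Q f → Agree P Q X
          agree-at-f {P} {Q} agree Pf≡Qf x with x F.≟ f
          ... | yes refl = cong (_∧ X f) Pf≡Qf
          ... | no x≢f   = agree-off-f {P} {Q} agree x x≢f

          separates-without-f : Separates W (X without f)
          separates-without-f P Q pmP pmQ fixP fixQ agree with lookup P f in Pf | lookup Q f in Qf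
          ... | true  | false = ⊥-elim (mismatch pmP pmQ fixP fixQ Pf Qf agree)
          ... | false | true  = ⊥-elim (mismatch pmQ pmP fixQ fixP Qf Pf (λ x → sym (agree x)))
          ... | true  | true  =
            separates-shrink sep′ P Q pmP pmQ fixP fixQ (agree-at-f {P} {Q} agree (trans Pf (sym Qf)))
          ... | false | false =
            separates-shrink sep′ P Q pmP pmQ fixP fixQ (agree-at-f {P} {Q} agree (trans Pf (sym Qf)))

        grows : ∀ X {x} → X x ≡ true → inside W x ≡ false → inside W′ x ≡ true →
                countInside X W < countInside X W′
        grows X {x} Xx out in′ = count-mono-< _ _ (λ x′ → ∧-mapʳ (X x′) (inside-mono x′)) x
          (trans (cong (X x ∧_) out) (∧-zeroʳ (X x))) (cong₂ _∧_ Xx in′)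

        dropping-f : ∀ {X} → X f ≡ true → countInside (X without f) W < countInside X W
        dropping-f {X} Xf =
          count-mono-< _ _ without-⊆ f (cong (_∧ inside W f) (without-f X)) (cong₂ _∧_ Xf f-inside)
          where
          without-f : ∀ X → (X without f) f ≡ false
          without-f X rewrite dec-true (f F.≟ f) refl = refl
          f-inside : inside W f ≡ true
          f-inside = inside-true W r∈f s∈f r≢s (W-on-f r∈f) (W-on-f s∈f)
          without-⊆ : ∀ x → (X without f) x ∧ inside W x ≡ true → X x ∧ inside W x ≡ true
          without-⊆ x h with x F.≟ f
          ... | no _ = h

        -- X contains e, x₁ or x₂, which lie inside W′ but not W; otherwise it contains f, since M and
        -- M swapped along the square differ only there, and then X without f separates for W.
        smaller-separator : ∀ {X} → Separates W′ X →
                            ∃[ X₀ ] (Separates W X₀ × countInside X₀ W < countInside X W′)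
        smaller-separator {X} sep′ with X e in Xe | X x₁ in Xx₁ | X x₂ in Xx₂
        ... | true  | _     | _     = X , separates-shrink sep′ ,
          grows X Xe (inside-false W p∈e (W-on-e p∈e))
                     (inside-true W′ p∈e q∈e p≢q (W′-on-e p∈e) (W′-on-e q∈e))
        ... | false | true  | _     = X , separates-shrink sep′ ,
          grows X Xx₁ (inside-false W p∈x₁ (W-on-e p∈e))
                      (inside-true W′ p∈x₁ r∈x₁ SwapM.p≢r (W′-on-e p∈e) (W′-on-f r∈f))
        ... | false | false | true  = X , separates-shrink sep′ ,
          grows X Xx₂ (inside-false W q∈x₂ (W-on-e q∈e))
                      (inside-true W′ q∈x₂ s∈x₂ SwapM.q≢s (W′-on-e q∈e) (W′-on-f s∈f))
        ... | false | false | false = X without f , separates-without-f sep′ Xe Xx₁ Xx₂ ,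
          <-≤-trans (dropping-f (f-separating sep′ Xe Xx₁ Xx₂))
                    (count-mono _ _ (λ x → ∧-mapʳ (X x) (inside-mono x)))

        bound′ : ∀ {j} → Bound W j → Bound W′ (suc j)
        bound′ bound X sep′ =
          let X₀ , sep₀ , X₀<X = smaller-separator sep′ in ≤-<-trans (bound X₀ sep₀) X₀<X

      record Stage (root : Fin N) (j : ℕ) : Set where
        field
          W        : Fin N → Bool
          closed   : Closed W
          bound    : Bound W j
          size     : count W ≡ 2 * suc j
          has-root : W root ≡ true

      initial-stage : ∀ root → Stage root 0
      initial-stage root = record
        { W        = λ a → does (cover a F.≟ cover root)
        ; closed   = λ a b cover≡ → cong (λ g → does (g F.≟ cover root)) cover≡
        ; bound    = λ _ _ → z≤n
        ; size     = count-cover (cover-∈ root)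
        ; has-root = dec-true (cover root F.≟ cover root) refl
        }

      next-stage : ∀ {root j} → Connected G → Stage root j → 2 * suc j < N → Stage root (suc j)
      next-stage {root} {j} connected
                 record { W = W ; closed = closed ; bound = bound ; size = size ; has-root = has-root } room
        with count-false (subst (_< N) (sym size) room)
      ... | z , Wz with crossing-edge W (connected root z) has-root Wz
      ... | _ , _ , Wa , Wb , _ , ay , by = record
        { W        = W′
        ; closed   = closed′
        ; bound    = bound′ bound
        ; size     = trans count-W′ (trans (cong (_+ 2) size)
                       (trans (+-comm (2 * suc j) 2) (sym (*-suc 2 (suc j)))))
        ; has-root = W⊆W′ has-root
        }
        where open Grow W closed Wa Wb ay by

      stage : Connected G → ∀ root j → 2 * suc j ≤ N → Stage root j
      stage connected root zero    _    = initial-stage root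
      stage connected root (suc j) room = next-stage connected (stage connected root j (<⇒≤ room′)) room′
        where
        room′ : 2 * suc j < N
        room′ = <-≤-trans (*-monoʳ-< 2 (n<1+n (suc j))) room

      global-forcing-separates : ∀ {S} W → GlobalForcingSet G S → Separates W (lookup S)
      global-forcing-separates {S} W gfs P Q pmP pmQ _ _ agree = gfs P Q pmP pmQ (lookup-injective λ x →
        trans (lookup-zipWith _∧_ x P S) (trans (agree x) (sym (lookup-zipWith _∧_ x Q S))))

      global-forcing-size : Connected G → ∀ root n′ → N ≡ 2 * suc n′ →
                            ∀ S → GlobalForcingSet G S → n′ ≤ ∣ S ∣
      global-forcing-size connected root n′ N≡ S gfs = begin
        n′                           ≤⟨ bound (lookup S) (global-forcing-separates W gfs) ⟩
        countInside (lookup S) W     ≤⟨ count-mono _ (lookup S) (λ x → ∧-projˡ {b = inside W x}) ⟩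
        count (lookup S)             ≡⟨ ∣p∣≡count S ⟨
        ∣ S ∣                         ∎
        where
        open Stage (stage connected root n′ (≤-reflexive (sym N≡)))
        open ≤-Reasoning

half : ∀ a s → a + a ≡ 2 * s → a ≡ s
half a s a+a≡2s = *-cancelˡ-≡ a s 2 (trans (cong (a +_) (+-identityʳ a)) a+a≡2s)

excess-of-nice : ∀ k s e → 4 * k + 2 * s ≡ 2 * e → e ∸ s ≡ k + k
excess-of-nice k s e 4k+2s≡2e = trans (cong (_∸ s) e≡) (m+n∸n≡m (k + k) s)
  where
  open +-*-Solver
  e≡ : e ≡ k + k + s
  e≡ = *-cancelˡ-≡ e (k + k + s) 2 (trans (sym 4k+2s≡2e)
         (solve 2 (λ k s → con 4 :* k :+ con 2 :* s := con 2 :* (k :+ k :+ s)) refl k s))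

corollary3p8 : (n : ℕ) (G : Graph (2 * n)) → Connected G →
    HasNicePerfectMatching G → (k : ℕ) → IsGf G k → n ∸ 1 ≤ k
corollary3p8 zero     G _ _ _ _ = z≤n
-- Only af(G,M) ≥ k and 4k + |V(G)| = 2|E(G)| are used, not the maximality of k.
corollary3p8 (suc n′) G connected (M , pm , k , (_ , af-lower) , _ , 4k+N≡2m) _ ((S , gfs , ∣S∣≡) , _) =
  subst (n′ ≤_) ∣S∣≡ (Tight.global-forcing-size G pm k af-lower excess connected F.zero n′ refl S gfs)
  where
  ∣M∣≡ : ∣ M ∣ ≡ suc n′
  ∣M∣≡ = half ∣ M ∣ (suc n′) (∣M∣+∣M∣≡N G pm)
  excess : m G ∸ ∣ M ∣ ≡ k + k
  excess = excess-of-nice k ∣ M ∣ (m G) (subst (λ s → 4 * k + 2 * s ≡ 2 * m G) (sym ∣M∣≡) 4k+N≡2m)
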